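{- For any nonnegative integers $a_1$ and $a_2$: $$*L_{a_1} + *L_{a_2} \equiv *L_{a_1 \oplus a_2}, \qquad *L_{a_1} + *R_{a_2} \equiv *R_{a_1 \oplus a_2}, \qquad *R_{a_1} + *R_{a_2} \equiv *L_{a_1 \oplus a_2}.$$
   Context: Positions are defined recursively: $*L$ and $*R$ are terminal positions; if $G_1,\dots,G_n$ ($n\ge 1$) are positions, then $\{G_1,\dots,G_n\}$ is a position with options $G_1,\dots,G_n$. All positions have finite game trees. Play: Left and Right move alternately, each choosing any option of the current position; when a terminal position is reached, Left wins if it is $*L$ and Right wins if it is $*R$. Disjunctive sum: $*L + *L = *R + *R = *L$, $*L + *R = *R + *L = *R$; if at least one of $G,H$ is non-terminal, $G+H$ has options all $G'+H$ ($G'$ an option of $G$) and all $G+H'$ ($H'$ an option of $H$). Outcome classes: $\mathcal{L}$ (Left wins moving first or second), $\mathcal{R}$ (Right wins moving first or second), $\mathcal{N}$ (first player wins), $\mathcal{P}$ (second player wins); $o(G)$ denotes the outcome class. Equivalence: $G \equiv H$ iff $o(G+X) = o(H+X)$ for every position $X$. Define $*L_0 = *L$, $*R_0 = *R$, and for $n \ge 1$, $*L_n = \{*L_{n-1}, \ldots, *L_0\}$ and $*R_n = \{*R_{n-1}, \ldots, *R_0\}$. The symbol $\oplus$ denotes bitwise XOR (nim-sum) of nonnegative integers in binary. -}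

module Defs where

open import Data.Nat using (ℕ; zero; suc; _+_; _*_)
open import Data.Nat.DivMod using (_/_; _%_)
open import Data.Bool using (Bool; true; false; _∧_; _∨_; not; if_then_else_)
open import Relation.Binary.PropositionalEquality using (_≡_)

-- Positions: *L, *R terminal, or {G₁,…,Gₙ} with n ≥ 1 options.
-- Inductive, hence every position has a finite game tree.

data Pos : Set
data Opts : Set

data Pos where
  *L *R : Pos
  node  : Opts → Pos

data Opts where
  [_] : Pos → Opts
  _∷_ : Pos → Opts → Opts

infixr 5 _∷_

data OptList : Set where
  []  : OptList
  _∷'_ : Pos → OptList → OptList

infixr 5 _∷'_

_++'_ : OptList → OptList → OptList
[] ++' ys = ys
(x ∷' xs) ++' ys = x ∷' (xs ++' ys)

toOpts : Opts → OptList
toOpts [ g ] = g ∷' []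
toOpts (g ∷ gs) = g ∷' toOpts gs

-- terminal positions become *L/*R themselves; nonempty lists become nodes
-- (only used on a nonempty list or with the given fallback)
fromList : Pos → OptList → Pos
fromList d [] = d
fromList d (x ∷' xs) = node (go x xs)
  where
  go : Pos → OptList → Opts
  go y [] = [ y ]
  go y (z ∷' zs) = y ∷ go z zs

infixl 6 _⊞_

_⊞_ : Pos → Pos → Pos
leftOpts  : Opts → Pos → OptList
rightOpts : Pos → Opts → OptList

*L ⊞ *L = *L
*L ⊞ *R = *R
*R ⊞ *L = *R
*R ⊞ *R = *L
*L ⊞ node hs = fromList *L (rightOpts *L hs)
*R ⊞ node hs = fromList *L (rightOpts *R hs)
node gs ⊞ *L = fromList *L (leftOpts gs *L)
node gs ⊞ *R = fromList *L (leftOpts gs *R)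
node gs ⊞ node hs = fromList *L (leftOpts gs (node hs) ++' rightOpts (node gs) hs)

leftOpts [ g ] h = (g ⊞ h) ∷' []
leftOpts (g ∷ gs) h = (g ⊞ h) ∷' leftOpts gs h

rightOpts g [ h ] = (g ⊞ h) ∷' []
rightOpts g (h ∷ hs) = (g ⊞ h) ∷' rightOpts g hs

-- Play. leftWinsL G : Left wins G when Left is to move;
--       leftWinsR G : Left wins G when Right is to move.
-- At a terminal position the winner is determined by the position.

leftWinsL : Pos → Bool
leftWinsR : Pos → Bool
anyLR : Opts → Bool
allLL : Opts → Bool

leftWinsL *L = true
leftWinsL *R = false
leftWinsL (node gs) = anyLR gs
leftWinsR *L = true
leftWinsR *R = false
leftWinsR (node gs) = allLL gs

anyLR [ g ] = leftWinsR g
anyLR (g ∷ gs) = leftWinsR g ∨ anyLR gs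
allLL [ g ] = leftWinsL g
allLL (g ∷ gs) = leftWinsL g ∧ allLL gs

data Outcome : Set where
  𝓛 𝓡 𝓝 𝓟 : Outcome

outcome : Pos → Outcome
outcome G with leftWinsL G | leftWinsR G
... | true  | true  = 𝓛
... | false | false = 𝓡
... | true  | false = 𝓝
... | false | true  = 𝓟

infix 4 _≡ᵍ_
_≡ᵍ_ : Pos → Pos → Set
G ≡ᵍ H = (X : Pos) → outcome (G ⊞ X) ≡ outcome (H ⊞ X)

starL : ℕ → Pos
downL : ℕ → Opts
starL zero = *L
starL (suc n) = node (downL n)
downL zero = [ *L ]
downL (suc n) = starL (suc n) ∷ downL n

starR : ℕ → Pos
downR : ℕ → Opts
starR zero = *R
starR (suc n) = node (downR n)
downR zero = [ *R ]
downR (suc n) = starR (suc n) ∷ downR n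

-- Nim-sum (bitwise XOR) on ℕ, by binary recursion with fuel a + b
-- (fuel is always sufficient: a/2 + b/2 < a + b whenever a + b > 0,
--  and with fuel 0 we have a = b = 0).

bitXor : ℕ → ℕ → ℕ
bitXor zero zero = zero
bitXor zero (suc _) = suc zero
bitXor (suc _) zero = suc zero
bitXor (suc _) (suc _) = zero

nimGo : ℕ → ℕ → ℕ → ℕ
nimGo zero a b = a + b
nimGo (suc k) a b = bitXor (a % 2) (b % 2) + 2 * nimGo k (a / 2) (b / 2)

_⊕_ : ℕ → ℕ → ℕ
a ⊕ b = nimGo (a + b) a b

-- Sprague–Grundy theory relative to a terminal. Call G a Grundy position with terminal s and
-- value n if every play of G ends in the terminal of s, no option of G has value n, and every
-- smaller value is the value of an option; *L_n and *R_n are such positions of value n.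
-- Values of a sum add by nim-sum, because the values a′ ⊕ b and a ⊕ b′ (a′ < a, b′ < b) avoid
-- a ⊕ b and cover everything below it, while terminals combine as in *L + *L = *R + *R = *L.
-- Two Grundy positions with the same terminal and value are interchangeable in every sum with
-- X: a winning move in G₁ + X is copied in X, matched in G₂ if it lowers the value, and
-- reversed if it raises it. Against a terminal X only the terminal of G matters.

module Submission where

open import Defs
open import Data.Bool using (Bool; true; false; not; _∧_; _∨_; _xor_; T)
open import Data.Bool.Properties
  using (not-involutive; not-injective; ∨-identityʳ; ∨-idem; xor-assoc; xor-comm; xor-same; xor-identityʳ; not-distribˡ-xor)
open import Data.Bool.ListAction using (any)
open import Data.Empty using (⊥; ⊥-elim)
open import Data.List using (List; []; _∷_; _++_; map; applyDownFrom)
open import Data.List.Properties using (++-identityʳ)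
open import Data.List.Membership.Propositional using (_∈_; find; lose)
open import Data.List.Membership.Propositional.Properties
  using (∈-map⁺; ∈-map⁻; ∈-++⁺ˡ; ∈-++⁺ʳ; ∈-++⁻; ∈-applyDownFrom⁺; ∈-applyDownFrom⁻)
open import Data.List.Relation.Unary.Any using (here; there)
open import Data.List.Relation.Unary.Any.Properties using (any⁺; any⁻)
open import Data.Nat using (ℕ; zero; suc; _+_; _*_; _≤_; _<_; z≤n; s≤s)
open import Data.Nat.Properties
open import Data.Nat.DivMod using (_/_; _%_; [m+kn]%n≡m%n; m*n%n≡0; m*n/n≡m; +-distrib-/-∣ʳ)
open import Data.Nat.Divisibility using (divides-refl)
open import Data.Nat.Induction using (<-rec)
open import Data.Product using (∃-syntax; ∃₂; _×_; _,_; proj₂)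
open import Data.Sum using (_⊎_; inj₁; inj₂)
open import Data.Unit using (⊤; tt)
open import Function using (_∘_)
open import Induction.WellFounded using (Acc; acc; WellFounded)
open import Relation.Binary.Definitions using (tri<; tri≈; tri>)
open import Relation.Binary.PropositionalEquality
open import Relation.Nullary using (¬_)

private
  variable
    s t : Bool
    n m : ℕ
    A B G H G₁ G₂ X : Pos

bit : Bool → ℕ
bit false = 0
bit true = 1

binary : ∀ a → ∃₂ λ p h → a ≡ bit p + 2 * h
binary zero = false , 0 , refl
binary (suc a) with binary a
... | false , h , refl = true , h , refl
... | true , h , refl = false , suc h , cong suc (sym (+-suc h (h + 0)))

[b+2h]%2≡b : ∀ p h → (bit p + 2 * h) % 2 ≡ bit p
[b+2h]%2≡b false h = trans (cong (_% 2) (*-comm 2 h)) (m*n%n≡0 h 2)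
[b+2h]%2≡b true h = trans (cong (λ x → (1 + x) % 2) (*-comm 2 h)) ([m+kn]%n≡m%n 1 h 2)

[b+2h]/2≡h : ∀ p h → (bit p + 2 * h) / 2 ≡ h
[b+2h]/2≡h false h = trans (cong (_/ 2) (*-comm 2 h)) (m*n/n≡m h 2)
[b+2h]/2≡h true h = begin
  (1 + 2 * h) / 2   ≡⟨ cong (λ x → (1 + x) / 2) (*-comm 2 h) ⟩
  (1 + h * 2) / 2   ≡⟨ +-distrib-/-∣ʳ 1 {d = 2} (divides-refl h) ⟩
  1 / 2 + h * 2 / 2 ≡⟨ cong (1 / 2 +_) (m*n/n≡m h 2) ⟩
  h                 ∎
  where open ≡-Reasoning

2*m≤1+n⇒m≤n : ∀ m n → 2 * m ≤ suc n → m ≤ n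
2*m≤1+n⇒m≤n zero n _ = z≤n
2*m≤1+n⇒m≤n (suc m) n 2+2m≤1+n = ≤-pred (≤-trans 2+m≤2+2m 2+2m≤1+n)
  where
  2+m≤2+2m : suc (suc m) ≤ 2 * suc m
  2+m≤2+2m = s≤s (subst (λ x → suc m ≤ m + suc x) (sym (+-identityʳ m)) (m≤n+m (suc m) m))

halves≤ : ∀ p h q j → bit p + 2 * h + (bit q + 2 * j) ≤ suc n → h + j ≤ n
halves≤ {n} p h q j le = 2*m≤1+n⇒m≤n (h + j) n (begin
  2 * (h + j)                      ≡⟨ *-distribˡ-+ 2 h j ⟩
  2 * h + 2 * j                    ≤⟨ +-mono-≤ (m≤n+m (2 * h) (bit p)) (m≤n+m (2 * j) (bit q)) ⟩
  bit p + 2 * h + (bit q + 2 * j)  ≤⟨ le ⟩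
  suc n                            ∎)
  where open ≤-Reasoning

bit+2*-mono-< : ∀ r s {l m} → l < m → bit r + 2 * l < bit s + 2 * m
bit+2*-mono-< r s {l} {m} l<m = begin-strict
  bit r + 2 * l  ≤⟨ +-monoˡ-≤ (2 * l) (bit≤1 r) ⟩
  1 + 2 * l      <⟨ ≤-reflexive (sym (*-suc 2 l)) ⟩
  2 * suc l      ≤⟨ *-monoʳ-≤ 2 l<m ⟩
  2 * m          ≤⟨ m≤n+m (2 * m) (bit s) ⟩
  bit s + 2 * m  ∎
  where
  open ≤-Reasoning
  bit≤1 : ∀ p → bit p ≤ 1
  bit≤1 false = z≤n
  bit≤1 true = s≤s z≤n

bit+2*-< : ∀ r s {l m} → bit r + 2 * l < bit s + 2 * m → l < m ⊎ (l ≡ m × r ≡ false × s ≡ true)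
bit+2*-< r s {l} {m} lt with <-cmp l m
... | tri< l<m _ _ = inj₁ l<m
... | tri≈ _ refl _ = inj₂ (refl , bit-< r s (+-cancelʳ-< (2 * l) (bit r) (bit s) lt))
  where
  bit-< : ∀ r s → bit r < bit s → r ≡ false × s ≡ true
  bit-< false true _ = refl , refl
  bit-< true true (s≤s ())
... | tri> _ _ m<l = ⊥-elim (<-asym lt (bit+2*-mono-< s r m<l))

nimGo-0-0 : ∀ k → nimGo k 0 0 ≡ 0
nimGo-0-0 zero = refl
nimGo-0-0 (suc k) = cong (2 *_) (nimGo-0-0 k)

nimGo-fuel : ∀ k l a b → a + b ≤ k → a + b ≤ l → nimGo k a b ≡ nimGo l a b
nimGo-fuel zero l zero zero _ _ = sym (nimGo-0-0 l)
nimGo-fuel (suc k) zero zero zero _ _ = nimGo-0-0 (suc k)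
nimGo-fuel (suc k) (suc l) a b a+b≤1+k a+b≤1+l =
  cong (λ x → bitXor (a % 2) (b % 2) + 2 * x)
       (nimGo-fuel k l (a / 2) (b / 2) (half-sum≤ a b a+b≤1+k) (half-sum≤ a b a+b≤1+l))
  where
  half-sum≤ : ∀ a b → a + b ≤ suc n → a / 2 + b / 2 ≤ n
  half-sum≤ a b a+b≤1+n with binary a | binary b
  ... | p , h , refl | q , j , refl
    rewrite [b+2h]/2≡h p h | [b+2h]/2≡h q j = halves≤ p h q j a+b≤1+n

bitXor-bit : ∀ p q → bitXor (bit p) (bit q) ≡ bit (p xor q)
bitXor-bit false false = refl
bitXor-bit false true = refl
bitXor-bit true false = refl
bitXor-bit true true = refl

⊕-binary : ∀ p h q j → (bit p + 2 * h) ⊕ (bit q + 2 * j) ≡ bit (p xor q) + 2 * (h ⊕ j)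
⊕-binary p h q j = begin
  a ⊕ b
    ≡⟨ nimGo-fuel (a + b) (suc (a + b)) a b ≤-refl (n≤1+n _) ⟩
  bitXor (a % 2) (b % 2) + 2 * nimGo (a + b) (a / 2) (b / 2)
    ≡⟨ cong₂ (λ x y → x + 2 * y) (cong₂ bitXor ([b+2h]%2≡b p h) ([b+2h]%2≡b q j))
                                  (cong₂ (nimGo (a + b)) ([b+2h]/2≡h p h) ([b+2h]/2≡h q j)) ⟩
  bitXor (bit p) (bit q) + 2 * nimGo (a + b) h j
    ≡⟨ cong₂ (λ x y → x + 2 * y) (bitXor-bit p q)
                                  (nimGo-fuel (a + b) (h + j) h j (halves≤ p h q j (n≤1+n _)) ≤-refl) ⟩
  bit (p xor q) + 2 * (h ⊕ j)
    ∎
  where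
  open ≡-Reasoning
  a = bit p + 2 * h
  b = bit q + 2 * j

binary-ind₂ : (P : ℕ → ℕ → Set) → P 0 0 →
              (∀ p h q j → P h j → P (bit p + 2 * h) (bit q + 2 * j)) →
              ∀ a b → P a b
binary-ind₂ P base step a b = go (a + b) a b ≤-refl
  where
  go : ∀ k a b → a + b ≤ k → P a b
  go zero zero zero _ = base
  go (suc k) a b a+b≤1+k with binary a | binary b
  ... | p , h , refl | q , j , refl = step p h q j (go k h j (halves≤ p h q j a+b≤1+k))

xor-cancelʳ : ∀ p q → (p xor q) xor q ≡ p
xor-cancelʳ p q = trans (xor-assoc p q q) (trans (cong (p xor_) (xor-same q)) (xor-identityʳ p))

xor-cancelˡ : ∀ p q → p xor (p xor q) ≡ q
xor-cancelˡ p q = trans (sym (xor-assoc p p q)) (cong (_xor q) (xor-same p))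

⊕-comm : ∀ a b → a ⊕ b ≡ b ⊕ a
⊕-comm = binary-ind₂ (λ a b → a ⊕ b ≡ b ⊕ a) refl λ p h q j ih → begin
  (bit p + 2 * h) ⊕ (bit q + 2 * j) ≡⟨ ⊕-binary p h q j ⟩
  bit (p xor q) + 2 * (h ⊕ j)       ≡⟨ cong₂ (λ r k → bit r + 2 * k) (xor-comm p q) ih ⟩
  bit (q xor p) + 2 * (j ⊕ h)       ≡⟨ ⊕-binary q j p h ⟨
  (bit q + 2 * j) ⊕ (bit p + 2 * h) ∎
  where open ≡-Reasoning

[a⊕b]⊕b≡a : ∀ a b → (a ⊕ b) ⊕ b ≡ a
[a⊕b]⊕b≡a = binary-ind₂ (λ a b → (a ⊕ b) ⊕ b ≡ a) refl λ p h q j ih → begin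
  ((bit p + 2 * h) ⊕ (bit q + 2 * j)) ⊕ (bit q + 2 * j) ≡⟨ cong (_⊕ (bit q + 2 * j)) (⊕-binary p h q j) ⟩
  (bit (p xor q) + 2 * (h ⊕ j)) ⊕ (bit q + 2 * j)       ≡⟨ ⊕-binary (p xor q) (h ⊕ j) q j ⟩
  bit ((p xor q) xor q) + 2 * ((h ⊕ j) ⊕ j)             ≡⟨ cong₂ (λ r k → bit r + 2 * k) (xor-cancelʳ p q) ih ⟩
  bit p + 2 * h                                         ∎
  where open ≡-Reasoning

⊕-cancelʳ-≡ : ∀ {a a′} b → a ⊕ b ≡ a′ ⊕ b → a ≡ a′
⊕-cancelʳ-≡ {a} {a′} b eq = trans (sym ([a⊕b]⊕b≡a a b)) (trans (cong (_⊕ b) eq) ([a⊕b]⊕b≡a a′ b))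

⊕-cancelˡ-≡ : ∀ a {b b′} → a ⊕ b ≡ a ⊕ b′ → b ≡ b′
⊕-cancelˡ-≡ a {b} {b′} eq = ⊕-cancelʳ-≡ a (trans (⊕-comm b a) (trans eq (⊕-comm a b′)))

Reachable : ℕ → ℕ → ℕ → Set
Reachable a b c = (∃[ a′ ] a′ < a × a′ ⊕ b ≡ c) ⊎ (∃[ b′ ] b′ < b × a ⊕ b′ ≡ c)

⊕-mex : ∀ a b {c} → c < a ⊕ b → Reachable a b c
⊕-mex = binary-ind₂ (λ a b → ∀ {c} → c < a ⊕ b → Reachable a b c) (λ ()) step
  where
  open ≡-Reasoning
  step : ∀ p h q j → (∀ {l} → l < h ⊕ j → Reachable h j l) →
         ∀ {c} → c < (bit p + 2 * h) ⊕ (bit q + 2 * j) → Reachable (bit p + 2 * h) (bit q + 2 * j) c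
  step p h q j ih {c} c< with binary c
  ... | r , l , refl
    with bit+2*-< r (p xor q) {l} {h ⊕ j} (subst (bit r + 2 * l <_) (⊕-binary p h q j) c<)
  ... | inj₂ (refl , refl , p⊕q≡1) = top-bit p q p⊕q≡1
    where
    top-bit : ∀ p q → p xor q ≡ true → Reachable (bit p + 2 * h) (bit q + 2 * j) (2 * (h ⊕ j))
    top-bit true false _ = inj₁ (2 * h , n<1+n _ , ⊕-binary false h false j)
    top-bit false true _ = inj₂ (2 * j , n<1+n _ , ⊕-binary false h false j)
  ... | inj₁ l< with ih l<
  ...   | inj₁ (h′ , h′<h , h′⊕j≡l) =
    inj₁ (bit (r xor q) + 2 * h′ , bit+2*-mono-< (r xor q) p h′<h , (begin
      (bit (r xor q) + 2 * h′) ⊕ (bit q + 2 * j) ≡⟨ ⊕-binary (r xor q) h′ q j ⟩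
      bit ((r xor q) xor q) + 2 * (h′ ⊕ j)       ≡⟨ cong₂ (λ r k → bit r + 2 * k) (xor-cancelʳ r q) h′⊕j≡l ⟩
      bit r + 2 * l                              ∎))
  ...   | inj₂ (j′ , j′<j , h⊕j′≡l) =
    inj₂ (bit (p xor r) + 2 * j′ , bit+2*-mono-< (p xor r) q j′<j , (begin
      (bit p + 2 * h) ⊕ (bit (p xor r) + 2 * j′) ≡⟨ ⊕-binary p h (p xor r) j′ ⟩
      bit (p xor (p xor r)) + 2 * (h ⊕ j′)       ≡⟨ cong₂ (λ r k → bit r + 2 * k) (xor-cancelˡ p r) h⊕j′≡l ⟩
      bit r + 2 * l                              ∎))

toList : Opts → List Pos
toList [ g ] = g ∷ []
toList (g ∷ gs) = g ∷ toList gs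

toList′ : OptList → List Pos
toList′ [] = []
toList′ (g ∷' gs) = g ∷ toList′ gs

options : Pos → List Pos
options *L = []
options *R = []
options (node gs) = toList gs

infix 4 _◁_
_◁_ : Pos → Pos → Set
B ◁ G = B ∈ options G

◁-wellFounded : WellFounded _◁_
◁-wellFounded *L = acc λ ()
◁-wellFounded *R = acc λ ()
◁-wellFounded (node gs) = acc (options-acc gs)
  where
  options-acc : ∀ gs {B} → B ∈ toList gs → Acc _◁_ B
  options-acc [ g ] (here refl) = ◁-wellFounded g
  options-acc (g ∷ gs) (here refl) = ◁-wellFounded g
  options-acc (g ∷ gs) (there B∈gs) = options-acc gs B∈gs

NonTerminal : Pos → Set
NonTerminal (node _) = ⊤
NonTerminal _ = ⊥

options-fromList : ∀ l → options (fromList *L l) ≡ toList′ l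
options-fromList [] = refl
options-fromList (x ∷' []) = refl
options-fromList (x ∷' y ∷' l) = cong (x ∷_) (options-fromList (y ∷' l))

toList′-++′ : ∀ xs ys → toList′ (xs ++' ys) ≡ toList′ xs ++ toList′ ys
toList′-++′ [] ys = refl
toList′-++′ (x ∷' xs) ys = cong (x ∷_) (toList′-++′ xs ys)

toList′-leftOpts : ∀ gs H → toList′ (leftOpts gs H) ≡ map (_⊞ H) (toList gs)
toList′-leftOpts [ g ] H = refl
toList′-leftOpts (g ∷ gs) H = cong (g ⊞ H ∷_) (toList′-leftOpts gs H)

toList′-rightOpts : ∀ G hs → toList′ (rightOpts G hs) ≡ map (G ⊞_) (toList hs)
toList′-rightOpts G [ h ] = refl
toList′-rightOpts G (h ∷ hs) = cong (G ⊞ h ∷_) (toList′-rightOpts G hs)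

⊞-options : ∀ G H → options (G ⊞ H) ≡ map (_⊞ H) (options G) ++ map (G ⊞_) (options H)
⊞-options *L *L = refl
⊞-options *L *R = refl
⊞-options *R *L = refl
⊞-options *R *R = refl
⊞-options *L (node hs) = trans (options-fromList _) (toList′-rightOpts *L hs)
⊞-options *R (node hs) = trans (options-fromList _) (toList′-rightOpts *R hs)
⊞-options (node gs) *L =
  trans (options-fromList _) (trans (toList′-leftOpts gs *L) (sym (++-identityʳ _)))
⊞-options (node gs) *R =
  trans (options-fromList _) (trans (toList′-leftOpts gs *R) (sym (++-identityʳ _)))
⊞-options (node gs) (node hs) = begin
  options (node gs ⊞ node hs)
    ≡⟨ options-fromList (leftOpts gs (node hs) ++' rightOpts (node gs) hs) ⟩
  toList′ (leftOpts gs (node hs) ++' rightOpts (node gs) hs)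
    ≡⟨ toList′-++′ (leftOpts gs (node hs)) (rightOpts (node gs) hs) ⟩
  toList′ (leftOpts gs (node hs)) ++ toList′ (rightOpts (node gs) hs)
    ≡⟨ cong₂ _++_ (toList′-leftOpts gs (node hs)) (toList′-rightOpts (node gs) hs) ⟩
  map (_⊞ node hs) (toList gs) ++ map (node gs ⊞_) (toList hs)
    ∎
  where open ≡-Reasoning

◁-⊞⁻ : ∀ G H → B ◁ G ⊞ H → (∃[ G′ ] G′ ◁ G × B ≡ G′ ⊞ H) ⊎ (∃[ H′ ] H′ ◁ H × B ≡ G ⊞ H′)
◁-⊞⁻ {B} G H B◁G⊞H with ∈-++⁻ (map (_⊞ H) (options G)) (subst (B ∈_) (⊞-options G H) B◁G⊞H)
... | inj₁ B∈ = inj₁ (∈-map⁻ (_⊞ H) B∈)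
... | inj₂ B∈ = inj₂ (∈-map⁻ (G ⊞_) B∈)

◁-⊞⁺ˡ : ∀ {G′} G H → G′ ◁ G → G′ ⊞ H ◁ G ⊞ H
◁-⊞⁺ˡ G H G′◁G = subst (_ ∈_) (sym (⊞-options G H)) (∈-++⁺ˡ (∈-map⁺ (_⊞ H) G′◁G))

◁-⊞⁺ʳ : ∀ {H′} G H → H′ ◁ H → G ⊞ H′ ◁ G ⊞ H
◁-⊞⁺ʳ G H H′◁H =
  subst (_ ∈_) (sym (⊞-options G H)) (∈-++⁺ʳ (map (_⊞ H) (options G)) (∈-map⁺ (G ⊞_) H′◁H))

⊞-nonTerminalˡ : ∀ G H → NonTerminal G → NonTerminal (G ⊞ H)
⊞-nonTerminalˡ (node [ _ ]) *L _ = tt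
⊞-nonTerminalˡ (node (_ ∷ _)) *L _ = tt
⊞-nonTerminalˡ (node [ _ ]) *R _ = tt
⊞-nonTerminalˡ (node (_ ∷ _)) *R _ = tt
⊞-nonTerminalˡ (node [ _ ]) (node _) _ = tt
⊞-nonTerminalˡ (node (_ ∷ _)) (node _) _ = tt

⊞-nonTerminalʳ : ∀ G H → NonTerminal H → NonTerminal (G ⊞ H)
⊞-nonTerminalʳ *L (node [ _ ]) _ = tt
⊞-nonTerminalʳ *L (node (_ ∷ _)) _ = tt
⊞-nonTerminalʳ *R (node [ _ ]) _ = tt
⊞-nonTerminalʳ *R (node (_ ∷ _)) _ = tt
⊞-nonTerminalʳ (node gs) (node hs) _ = ⊞-nonTerminalˡ (node gs) (node hs) tt

-- win p A: whether player p (true for Left) wins A when moving first.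
win : Bool → Pos → Bool
win true A = leftWinsL A
win false A = not (leftWinsR A)

any-uniform : ∀ {X : Set} {f : X → Bool} {b x xs} → x ∈ xs → (∀ {y} → y ∈ xs → f y ≡ b) → any f xs ≡ b
any-uniform {xs = y ∷ []} _ f≡b = trans (∨-identityʳ _) (f≡b (here refl))
any-uniform {b = b} {xs = y ∷ z ∷ zs} _ f≡b =
  trans (cong₂ _∨_ (f≡b (here refl)) (any-uniform (here refl) (f≡b ∘ there))) (∨-idem b)

nonTerminal-option : NonTerminal A → ∃[ B ] B ◁ A
nonTerminal-option {node [ g ]} _ = g , here refl
nonTerminal-option {node (g ∷ gs)} _ = g , here refl

win-nonTerminal : ∀ p → NonTerminal A → win p A ≡ any (not ∘ win (not p)) (options A)
win-nonTerminal {node os} true _ = anyLR-any os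
  where
  anyLR-any : ∀ os → anyLR os ≡ any (not ∘ not ∘ leftWinsR) (toList os)
  anyLR-any [ g ] = sym (trans (∨-identityʳ _) (not-involutive _))
  anyLR-any (g ∷ gs) = cong₂ _∨_ (sym (not-involutive _)) (anyLR-any gs)
win-nonTerminal {node os} false _ = not-allLL-any os
  where
  not-∧ : ∀ x y → not (x ∧ y) ≡ not x ∨ not y
  not-∧ false y = refl
  not-∧ true y = refl
  not-allLL-any : ∀ os → not (allLL os) ≡ any (not ∘ leftWinsL) (toList os)
  not-allLL-any [ g ] = sym (∨-identityʳ _)
  not-allLL-any (g ∷ gs) = trans (not-∧ (leftWinsL g) (allLL gs)) (cong (not (leftWinsL g) ∨_) (not-allLL-any gs))

win-node⁺ : ∀ p → NonTerminal A → B ◁ A → T (not (win (not p) B)) → T (win p A)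
win-node⁺ p nt B◁A lost = subst T (sym (win-nonTerminal p nt)) (any⁺ _ (lose B◁A lost))

win-node⁻ : ∀ p → NonTerminal A → T (win p A) → ∃[ B ] B ◁ A × T (not (win (not p) B))
win-node⁻ {A} p nt won = find (any⁻ _ (options A) (subst T (win-nonTerminal p nt) won))

T-not⇒¬T : ∀ {b} → T (not b) → ¬ T b
T-not⇒¬T {false} _ ()

T-not-contra : ∀ {a b} → (T b → T a) → T (not a) → T (not b)
T-not-contra {b = false} _ _ = tt
T-not-contra {b = true} b⇒a ¬a = ⊥-elim (T-not⇒¬T ¬a (b⇒a tt))

T-⇔⇒≡ : ∀ {a b} → (T a → T b) → (T b → T a) → a ≡ b
T-⇔⇒≡ {false} {false} _ _ = refl
T-⇔⇒≡ {false} {true} _ b⇒a = ⊥-elim (b⇒a tt)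
T-⇔⇒≡ {true} {false} a⇒b _ = ⊥-elim (a⇒b tt)
T-⇔⇒≡ {true} {true} _ _ = refl

lose-node⁻ : ∀ p → NonTerminal A → T (not (win p A)) → B ◁ A → T (win (not p) B)
lose-node⁻ {A} {B} p nt lost B◁A with win (not p) B in eq
... | true = tt
... | false = ⊥-elim (T-not⇒¬T lost (win-node⁺ p nt B◁A (subst (T ∘ not) (sym eq) tt)))

win-uniform : ∀ p v → NonTerminal A → (∀ {B} → B ◁ A → win (not p) B ≡ not v) → win p A ≡ v
win-uniform p v nt uniform =
  trans (win-nonTerminal p nt)
        (any-uniform (proj₂ (nonTerminal-option nt)) λ B◁A → trans (cong not (uniform B◁A)) (not-involutive v))

star : Bool → ℕ → Pos
star true = starL
star false = starR

term : Bool → Pos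
term s = star s 0

xnor : Bool → Bool → Bool
xnor p q = not (p xor q)

term-⊞ : ∀ s t → term s ⊞ term t ≡ term (xnor s t)
term-⊞ false false = refl
term-⊞ false true = refl
term-⊞ true false = refl
term-⊞ true true = refl

win-term : ∀ p v → win p (term v) ≡ xnor p v
win-term false false = refl
win-term false true = refl
win-term true false = refl
win-term true true = refl

¬◁term : ∀ s → ¬ (B ◁ term s)
¬◁term false ()
¬◁term true ()

data Grundy (s : Bool) : ℕ → Pos → Set where
  terminal : Grundy s 0 (term s)
  node : ∀ {n os} →
         (∀ {G′} → G′ ◁ node os → ∃[ m ] m ≢ n × Grundy s m G′) →
         (∀ {m} → m < n → ∃[ G′ ] G′ ◁ node os × Grundy s m G′) →
         Grundy s n (node os)

grundy-node : NonTerminal G →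
              (∀ {G′} → G′ ◁ G → ∃[ m ] m ≢ n × Grundy s m G′) →
              (∀ {m} → m < n → ∃[ G′ ] G′ ◁ G × Grundy s m G′) →
              Grundy s n G
grundy-node {node _} _ = node

grundy-option : Grundy s n G → ∀ {G′} → G′ ◁ G → ∃[ m ] m ≢ n × Grundy s m G′
grundy-option {s} terminal G′◁G = ⊥-elim (¬◁term s G′◁G)
grundy-option (node option _) = option

grundy-below : Grundy s n G → m < n → ∃[ G′ ] G′ ◁ G × Grundy s m G′
grundy-below (node _ below) = below

win-⊞-term : Grundy s n G → ∀ x p → win p (G ⊞ term x) ≡ xnor p (xnor s x)
win-⊞-term {s} terminal x p = trans (cong (win p) (term-⊞ s x)) (win-term p (xnor s x))
win-⊞-term {s} {G = node os} (node option _) x p = win-uniform p _ (⊞-nonTerminalˡ (node os) (term x) tt) opponent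
  where
  opponent : ∀ {B} → B ◁ node os ⊞ term x → win (not p) B ≡ not (xnor p (xnor s x))
  opponent B◁ with ◁-⊞⁻ (node os) (term x) B◁
  ... | inj₂ (_ , ◁term , _) = ⊥-elim (¬◁term x ◁term)
  ... | inj₁ (G′ , G′◁G , refl) with option G′◁G
  ...   | _ , _ , G′-grundy =
    trans (win-⊞-term G′-grundy x (not p)) (cong not (sym (not-distribˡ-xor p (xnor s x))))

grundy-⊞ : Grundy s n G → Grundy t m H → Grundy (xnor s t) (n ⊕ m) (G ⊞ H)
grundy-⊞ = sum (◁-wellFounded _) (◁-wellFounded _)
  where
  sum : ∀ {s t n m G H} → Acc _◁_ G → Acc _◁_ H → Grundy s n G → Grundy t m H →
        Grundy (xnor s t) (n ⊕ m) (G ⊞ H)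
  sum-node : ∀ {s t n m G H} → Acc _◁_ G → Acc _◁_ H → Grundy s n G → Grundy t m H →
             NonTerminal (G ⊞ H) → Grundy (xnor s t) (n ⊕ m) (G ⊞ H)

  sum {s = s} {t = t} _ _ terminal terminal =
    subst (Grundy (xnor s t) 0) (sym (term-⊞ s t)) (terminal {xnor s t})
  sum {s = s} {H = H} aG aH terminal hH@(node _ _) = sum-node {s} aG aH terminal hH (⊞-nonTerminalʳ (term s) H tt)
  sum {G = G} {H = H} aG aH hG@(node _ _) hH = sum-node aG aH hG hH (⊞-nonTerminalˡ G H tt)

  sum-node {s} {t} {n} {m} {G} {H} aG@(acc rsG) aH@(acc rsH) hG hH nt =
    grundy-node nt option below
    where
    option : ∀ {B} → B ◁ G ⊞ H → ∃[ c ] c ≢ n ⊕ m × Grundy (xnor s t) c B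
    option B◁ with ◁-⊞⁻ G H B◁
    ... | inj₁ (G′ , G′◁G , refl) with grundy-option hG G′◁G
    ...   | n′ , n′≢n , hG′ = n′ ⊕ m , n′≢n ∘ ⊕-cancelʳ-≡ m , sum (rsG G′◁G) aH hG′ hH
    option B◁ | inj₂ (H′ , H′◁H , refl) with grundy-option hH H′◁H
    ...   | m′ , m′≢m , hH′ = n ⊕ m′ , m′≢m ∘ ⊕-cancelˡ-≡ n , sum aG (rsH H′◁H) hG hH′
    below : ∀ {c} → c < n ⊕ m → ∃[ B ] B ◁ G ⊞ H × Grundy (xnor s t) c B
    below c< with ⊕-mex n m c<
    ... | inj₁ (n′ , n′<n , refl) with grundy-below hG n′<n
    ...   | G′ , G′◁G , hG′ = G′ ⊞ H , ◁-⊞⁺ˡ G H G′◁G , sum (rsG G′◁G) aH hG′ hH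
    below c< | inj₂ (m′ , m′<m , refl) with grundy-below hH m′<m
    ...   | H′ , H′◁H , hH′ = G ⊞ H′ , ◁-⊞⁺ʳ G H H′◁H , sum aG (rsH H′◁H) hG hH′

grundy-interchange : Grundy s n G₁ → Grundy s n G₂ → ∀ X p → T (win p (G₁ ⊞ X)) → T (win p (G₂ ⊞ X))
grundy-interchange h₁ h₂ X = go (◁-wellFounded _) (◁-wellFounded _) (◁-wellFounded X) h₁ h₂
  where
  go : ∀ {s n G₁ G₂ X} → Acc _◁_ G₁ → Acc _◁_ G₂ → Acc _◁_ X → Grundy s n G₁ → Grundy s n G₂ →
       ∀ p → T (win p (G₁ ⊞ X)) → T (win p (G₂ ⊞ X))
  go {X = *L} _ _ _ h₁ h₂ p won = subst T (trans (win-⊞-term h₁ true p) (sym (win-⊞-term h₂ true p))) won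
  go {X = *R} _ _ _ h₁ h₂ p won = subst T (trans (win-⊞-term h₁ false p) (sym (win-⊞-term h₂ false p))) won
  go {n = n} {G₁} {G₂} {X@(node _)} aG₁@(acc rs₁) aG₂@(acc rs₂) aX@(acc rsX) h₁ h₂ p won
    with win-node⁻ p (⊞-nonTerminalʳ G₁ X tt) won
  ... | B , B◁ , B-lost with ◁-⊞⁻ G₁ X B◁
  ... | inj₂ (X′ , X′◁X , refl) =
    win-node⁺ p (⊞-nonTerminalʳ G₂ X tt) (◁-⊞⁺ʳ G₂ X X′◁X)
      (T-not-contra (go aG₂ aG₁ (rsX X′◁X) h₂ h₁ (not p)) B-lost)
  ... | inj₁ (G₁′ , G₁′◁G₁ , refl) with grundy-option h₁ G₁′◁G₁
  ...   | n′ , n′≢n , h₁′ with <-cmp n′ n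
  ...     | tri≈ _ n′≡n _ = ⊥-elim (n′≢n n′≡n)
  ...     | tri< n′<n _ _ =
    let G₂′ , G₂′◁G₂ , h₂′ = grundy-below h₂ n′<n in
    win-node⁺ p (⊞-nonTerminalʳ G₂ X tt) (◁-⊞⁺ˡ G₂ X G₂′◁G₂)
      (T-not-contra (go (rs₂ G₂′◁G₂) (rs₁ G₁′◁G₁) aX h₂′ h₁′ (not p)) B-lost)
  -- A move raising the value is reversed: G₁′ has an option G₁″ of value n.
  ...     | tri> _ _ n<n′ with grundy-below h₁′ n<n′ | rs₁ G₁′◁G₁
  ...       | G₁″ , G₁″◁G₁′ , h₁″ | acc rs₁′ =
    go (rs₁′ G₁″◁G₁′) aG₂ aX h₁″ h₂ p
      (subst (λ q → T (win q (G₁″ ⊞ X))) (not-involutive p)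
        (lose-node⁻ (not p) (⊞-nonTerminalʳ G₁′ X tt) B-lost (◁-⊞⁺ˡ G₁′ X G₁″◁G₁′)))

outcome-cong : leftWinsL A ≡ leftWinsL B → leftWinsR A ≡ leftWinsR B → outcome A ≡ outcome B
outcome-cong {A} {B} eqL eqR
  with leftWinsL A | leftWinsR A | leftWinsL B | leftWinsR B | eqL | eqR
... | true  | true  | _ | _ | refl | refl = refl
... | true  | false | _ | _ | refl | refl = refl
... | false | true  | _ | _ | refl | refl = refl
... | false | false | _ | _ | refl | refl = refl

grundy-≡ᵍ : Grundy s n G₁ → Grundy s n G₂ → G₁ ≡ᵍ G₂
grundy-≡ᵍ {G₁ = G₁} {G₂ = G₂} h₁ h₂ X =
  outcome-cong {G₁ ⊞ X} {G₂ ⊞ X} (same-win true) (not-injective (same-win false))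
  where
  same-win : ∀ p → win p (G₁ ⊞ X) ≡ win p (G₂ ⊞ X)
  same-win p = T-⇔⇒≡ (grundy-interchange h₁ h₂ X p) (grundy-interchange h₂ h₁ X p)

options-star : ∀ s n → options (star s n) ≡ applyDownFrom (star s) n
options-star false zero = refl
options-star true zero = refl
options-star false (suc zero) = refl
options-star true (suc zero) = refl
options-star false (suc (suc n)) = cong (starR (suc n) ∷_) (options-star false (suc n))
options-star true (suc (suc n)) = cong (starL (suc n) ∷_) (options-star true (suc n))

star-nonTerminal : ∀ s n → NonTerminal (star s (suc n))
star-nonTerminal false n = tt
star-nonTerminal true n = tt

grundy-star : ∀ s n → Grundy s n (star s n)
grundy-star s = <-rec (λ n → Grundy s n (star s n)) step
  where
  step : ∀ n → (∀ {m} → m < n → Grundy s m (star s m)) → Grundy s n (star s n)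
  step zero _ = terminal
  step (suc n) ih = grundy-node (star-nonTerminal s n) option below
    where
    option : ∀ {B} → B ◁ star s (suc n) → ∃[ m ] m ≢ suc n × Grundy s m B
    option B◁ with ∈-applyDownFrom⁻ (star s) (subst (_ ∈_) (options-star s (suc n)) B◁)
    ... | m , m<1+n , refl = m , <⇒≢ m<1+n , ih m<1+n
    below : ∀ {m} → m < suc n → ∃[ B ] B ◁ star s (suc n) × Grundy s m B
    below {m} m<1+n =
      star s m , subst (_ ∈_) (sym (options-star s (suc n))) (∈-applyDownFrom⁺ (star s) m<1+n) , ih m<1+n

star-⊞ : ∀ s t a b → star s a ⊞ star t b ≡ᵍ star (xnor s t) (a ⊕ b)
star-⊞ s t a b =
  grundy-≡ᵍ (grundy-⊞ (grundy-star s a) (grundy-star t b)) (grundy-star (xnor s t) (a ⊕ b))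

corollary3p4 : (a₁ a₂ : ℕ) →
    (starL a₁ ⊞ starL a₂ ≡ᵍ starL (a₁ ⊕ a₂)) ×
    (starL a₁ ⊞ starR a₂ ≡ᵍ starR (a₁ ⊕ a₂)) ×
    (starR a₁ ⊞ starR a₂ ≡ᵍ starL (a₁ ⊕ a₂))
corollary3p4 a₁ a₂ = star-⊞ true true a₁ a₂ , star-⊞ true false a₁ a₂ , star-⊞ false false a₁ a₂
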